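{- Let $p,r$ be natural numbers with $0<r<p$ and $\gcd(r,2p)=1$. Then for every integer $n\ge 0$, $$E_{r}\big(2pn+r(p-r);2p\big)=\sum_{\substack{k,l\in\mathbb{Z}\\ k\ge|l|\\ n=p(k^2-l^2)/2+p(k+l)/2-lr}}(-1)^{k+l},$$ where the sum runs over all pairs of integers $(k,l)$ with $k\ge |l|$ satisfying $n=\frac{p(k^2-l^2)}{2}+\frac{p(k+l)}{2}-lr$.
   Context: For positive integers $N$ and $m$ and an integer $r$, define $E_{r}(N;m)=\#\{d\ge 1: d\mid N,\ d\equiv r \pmod m\}-\#\{d\ge 1: d\mid N,\ d\equiv -r\pmod m\}$, i.e. the number of positive divisors of $N$ congruent to $r$ modulo $m$ minus the number of positive divisors of $N$ congruent to $-r$ modulo $m$. -}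

module Defs where

open import Data.Nat as ℕ using (ℕ; zero; suc)
open import Data.Nat.Divisibility using (_∣?_)
open import Data.Integer as ℤ using (ℤ; +_; ∣_∣)
open import Data.List using (List; []; _∷_; map; upTo; filter; length; concatMap)
open import Data.Product using (_×_; _,_)
open import Relation.Nullary using (yes; no)

divisors : ℕ → List ℕ
divisors N = filter (λ d → d ∣? N) (map suc (upTo N))

-- d ≡ r (mod m) for d : ℕ, r : ℤ, expressed as m ∣ (d - r) in ℤ (i.e. m ∣ |d - r|)
-- E r (N ; m) : #{d ∣ N : d ≡ r mod m} - #{d ∣ N : d ≡ -r mod m}
E : (r : ℤ) (N m : ℕ) → ℤ
E r N m =
  (+ length (filter (λ d → m ∣? ∣ + d ℤ.- r ∣) (divisors N)))
  ℤ.- (+ length (filter (λ d → m ∣? ∣ + d ℤ.+ r ∣) (divisors N)))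

sign : ℕ → ℤ
sign zero = + 1
sign (suc a) = ℤ.- sign a

sumℤ : List ℤ → ℤ
sumℤ [] = + 0
sumℤ (x ∷ xs) = x ℤ.+ sumℤ xs

-- The (finite) set of integer pairs (k , l) with k ≥ |l| and
--   n = p(k² - l²)/2 + p(k + l)/2 - l r,
-- written (multiplying by 2, exact since k²-l²+k+l = (k+l)(k-l+1) is even) as
--   2n = p(k² - l²) + p(k + l) - 2 l r.
-- Every solution satisfies 0 ≤ k ≤ 2n (when 0 < r < p), so enumerating k ∈ [0, 2n],
-- l ∈ [-k, k] covers all solutions; k + l ≥ 0 so (-1)^(k+l) = sign ∣ k + l ∣.
pairs : ℕ → List (ℤ × ℤ)
pairs n = concatMap (λ k → map (λ j → (+ k , + j ℤ.- + k)) (upTo (suc (2 ℕ.* k))))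
                    (upTo (suc (2 ℕ.* n)))

isSol : (p r n : ℕ) → ℤ × ℤ → ℤ
isSol p r n (k , l) with (+ (2 ℕ.* n)) ℤ.≟
    ((+ p) ℤ.* (k ℤ.* k ℤ.- l ℤ.* l) ℤ.+ (+ p) ℤ.* (k ℤ.+ l) ℤ.- (+ 2) ℤ.* l ℤ.* (+ r))
... | yes _ = sign ∣ k ℤ.+ l ∣
... | no _ = + 0

signedSum : (p r n : ℕ) → ℤ
signedSum p r n = sumℤ (map (isSol p r n) (pairs n))

{-# OPTIONS --safe #-}
-- Put q = p - r, j = k + l and y = k - l, so that j + y = 2k and j ≡ y (mod 2). The equation for
-- (k, l) becomes 2n = j(py + q) + ry, i.e. N = 2pn + rq = (pj + r)(py + q). Modulo 2p the two
-- factors are ≡ r and q when j, y are even, and ≡ -q and -r when they are odd. Conversely, as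
-- N ≡ rq (mod 2p) and r is invertible modulo 2p, the cofactor of a divisor d ≡ r is ≡ q, and that
-- of a divisor d ≡ -r is ≡ -q. Hence (k, l) ↦ p(k + l) + r is a bijection from the solutions with
-- k + l even onto the divisors ≡ r of N, and (k, l) ↦ p(k - l) + q one from the solutions with
-- k + l odd onto the divisors ≡ -r; the sign (-1)^(k+l) turns the sum into the difference of counts.
module Submission where

open import Defs
open import Data.Nat.Base as ℕ using (ℕ; zero; suc; _+_; _*_; _∸_; _<_; _≤_; s≤s)
import Data.Nat.Properties as ℕ
open import Data.Nat.Divisibility using (_∣_; divides; _∣?_; ∣⇒≤; >⇒∤; ∣m+n∣m⇒∣n; m∣m*n)
open import Data.Nat.Coprimality as Coprime using (Coprime; coprime-divisor; gcd≡1⇒coprime)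
open import Data.Nat.GCD using (gcd)
open import Data.Integer.Base as ℤ using (ℤ; +_; ∣_∣)
import Data.Integer.Properties as ℤ
open import Data.Product using (_×_; _,_; proj₁; proj₂; ∃-syntax)
open import Data.Sum using (_⊎_; inj₁; inj₂)
open import Data.List.Base using (List; []; _∷_; map; upTo; filter; length)
open import Data.List.Membership.Propositional using (_∈_; find; lose)
open import Data.List.Membership.Propositional.Properties
  using (∈-map⁺; ∈-map⁻; ∈-upTo⁺; ∈-upTo⁻; ∈-filter⁺; ∈-filter⁻; ∈-concatMap⁺; ∈-concatMap⁻)
open import Data.List.Membership.Propositional.Properties.WithK using (unique∧set⇒bag)
import Data.List.Relation.Unary.All as All
import Data.List.Relation.Unary.All.Properties as All
open import Data.List.Relation.Unary.Any using (here; there)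
import Data.List.Relation.Unary.AllPairs as AllPairs
import Data.List.Relation.Unary.AllPairs.Properties as AllPairs
open import Data.List.Relation.Unary.Unique.Propositional using (Unique; []; _∷_)
import Data.List.Relation.Unary.Unique.Propositional.Properties as Unique
open import Data.List.Relation.Binary.Disjoint.Propositional using (Disjoint)
open import Data.List.Relation.Binary.BagAndSetEquality using (∼bag⇒↭)
open import Data.List.Relation.Binary.Permutation.Propositional.Properties using (↭-length)
open import Data.List.Properties using (length-map)
open import Function.Bundles using (_⇔_; mk⇔; Equivalence)
open import Relation.Nullary using (Dec; yes; no)
open import Relation.Nullary.Decidable using (_×-dec_)
open import Relation.Nullary.Negation using (contradiction)
open import Relation.Binary.PropositionalEquality
open import Data.Nat.Tactic.RingSolver using (solve)
import Data.Integer.Tactic.RingSolver as ℤ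

module _ {a b} {A : Set a} {B : Set b} (f : A → B) where

  map-injectiveOn⁺ : ∀ {xs} → Unique xs →
                     (∀ {x y} → x ∈ xs → y ∈ xs → f x ≡ f y → x ≡ y) →
                     Unique (map f xs)
  map-injectiveOn⁺ [] _ = []
  map-injectiveOn⁺ (x∉xs ∷ xs!) inj =
    All.map⁺ (All.tabulate λ y∈xs fx≡fy → All.lookup x∉xs y∈xs (inj (here refl) (there y∈xs) fx≡fy))
    ∷ map-injectiveOn⁺ xs! (λ x∈xs y∈xs → inj (there x∈xs) (there y∈xs))

  length-≡-via-bijection : ∀ {xs ys} → Unique xs → Unique ys →
                           (∀ {x y} → x ∈ xs → y ∈ xs → f x ≡ f y → x ≡ y) →
                           (∀ {x} → x ∈ xs → f x ∈ ys) →
                           (∀ {y} → y ∈ ys → ∃[ x ] x ∈ xs × f x ≡ y) →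
                           length xs ≡ length ys
  length-≡-via-bijection {xs} {ys} xs! ys! inj into onto = begin
    length xs         ≡⟨ length-map f xs ⟨
    length (map f xs) ≡⟨ ↭-length (∼bag⇒↭ (unique∧set⇒bag (map-injectiveOn⁺ xs! inj) ys! (mk⇔ to from))) ⟩
    length ys         ∎
    where
    open ≡-Reasoning
    to : ∀ {y} → y ∈ map f xs → y ∈ ys
    to y∈ with _ , x∈xs , refl ← ∈-map⁻ f y∈ = into x∈xs
    from : ∀ {y} → y ∈ ys → y ∈ map f xs
    from y∈ with _ , x∈xs , refl ← onto y∈ = ∈-map⁺ f x∈xs

sign-+ : ∀ a b → sign (a + b) ≡ sign a ℤ.* sign b
sign-+ zero    b = sym (ℤ.*-identityˡ (sign b))
sign-+ (suc a) b = trans (cong ℤ.-_ (sign-+ a b)) (ℤ.neg-distribˡ-* (sign a) (sign b))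

sign*sign≡1 : ∀ a → sign a ℤ.* sign a ≡ + 1
sign*sign≡1 zero    = refl
sign*sign≡1 (suc a) = trans (neg*neg (sign a)) (sign*sign≡1 a)
  where
  neg*neg : ∀ x → ℤ.- x ℤ.* ℤ.- x ≡ x ℤ.* x
  neg*neg = ℤ.solve-∀

sign-2* : ∀ k → sign (2 * k) ≡ + 1
sign-2* k = begin
  sign (k + (k + 0))        ≡⟨ sign-+ k (k + 0) ⟩
  sign k ℤ.* sign (k + 0)   ≡⟨ cong (λ m → sign k ℤ.* sign m) (ℕ.+-identityʳ k) ⟩
  sign k ℤ.* sign k         ≡⟨ sign*sign≡1 k ⟩
  + 1                       ∎
  where open ≡-Reasoning

sign-1+2* : ∀ k → sign (1 + 2 * k) ≡ ℤ.- + 1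
sign-1+2* k = cong ℤ.-_ (sign-2* k)

j+y≡2k⇒sign-j≡sign-y : ∀ {j y k} → j + y ≡ 2 * k → sign j ≡ sign y
j+y≡2k⇒sign-j≡sign-y {j} {y} {k} j+y≡2k = begin
  sign j                             ≡⟨ ℤ.*-identityʳ (sign j) ⟨
  sign j ℤ.* + 1                     ≡⟨ cong (sign j ℤ.*_) (sign-2* k) ⟨
  sign j ℤ.* sign (2 * k)            ≡⟨ cong (λ m → sign j ℤ.* sign m) j+y≡2k ⟨
  sign j ℤ.* sign (j + y)            ≡⟨ cong (sign j ℤ.*_) (sign-+ j y) ⟩
  sign j ℤ.* (sign j ℤ.* sign y)     ≡⟨ ℤ.*-assoc (sign j) (sign j) (sign y) ⟨
  (sign j ℤ.* sign j) ℤ.* sign y     ≡⟨ cong (ℤ._* sign y) (sign*sign≡1 j) ⟩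
  + 1 ℤ.* sign y                     ≡⟨ ℤ.*-identityˡ (sign y) ⟩
  sign y                             ∎
  where open ≡-Reasoning

even⊎odd : ∀ a → ∃[ t ] (a ≡ 2 * t ⊎ a ≡ 1 + 2 * t)
even⊎odd zero = 0 , inj₁ refl
even⊎odd (suc a) with even⊎odd a
... | t , inj₁ refl = t , inj₂ refl
... | t , inj₂ refl = suc t , inj₁ (cong suc (sym (ℕ.+-suc t (t + 0))))

sign≡±1 : ∀ a → sign a ≡ + 1 ⊎ sign a ≡ ℤ.- + 1
sign≡±1 a with even⊎odd a
... | t , inj₁ refl = inj₁ (sign-2* t)
... | t , inj₂ refl = inj₂ (sign-1+2* t)

sign≡1⇒even : ∀ {a} → sign a ≡ + 1 → ∃[ t ] a ≡ 2 * t
sign≡1⇒even {a} s≡1 with even⊎odd a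
... | t , inj₁ a≡2t = t , a≡2t
... | t , inj₂ refl = contradiction (trans (sym (sign-1+2* t)) s≡1) λ ()

sign≡-1⇒odd : ∀ {a} → sign a ≡ ℤ.- + 1 → ∃[ t ] a ≡ 1 + 2 * t
sign≡-1⇒odd {a} s≡-1 with even⊎odd a
... | t , inj₁ refl = contradiction (trans (sym (sign-2* t)) s≡-1) λ ()
... | t , inj₂ a≡1+2t = t , a≡1+2t

∣+m-+n∣≡m∸n : ∀ {m n} → n ≤ m → ∣ + m ℤ.- + n ∣ ≡ m ∸ n
∣+m-+n∣≡m∸n {m} {n} n≤m =
  trans (cong ∣_∣ (ℤ.[+m]-[+n]≡m⊖n m n)) (trans (ℤ.∣m⊖n∣≡∣n⊖m∣ m n) (ℤ.∣⊖∣-≤ n≤m))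

∣+m-+n∣≡n∸m : ∀ {m n} → m < n → ∣ + m ℤ.- + n ∣ ≡ n ∸ m
∣+m-+n∣≡n∸m {m} {n} m<n = trans (cong ∣_∣ (ℤ.[+m]-[+n]≡m⊖n m n)) (ℤ.∣⊖∣-< m<n)

∣+[m+n]-+n∣≡m : ∀ m n → ∣ + (m + n) ℤ.- + n ∣ ≡ m
∣+[m+n]-+n∣≡m m n = trans (∣+m-+n∣≡m∸n (ℕ.m≤n+m n m)) (ℕ.m+n∸n≡m m n)

m∣∣d-r∣⇒d≡r+t*m : ∀ {m d r} → r < m → m ∣ ∣ + d ℤ.- + r ∣ → ∃[ t ] d ≡ r + t * m
m∣∣d-r∣⇒d≡r+t*m {m} {d} {r} r<m m∣∣d-r∣ with r ℕ.≤? d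
... | yes r≤d with divides t d∸r≡t*m ← subst (m ∣_) (∣+m-+n∣≡m∸n r≤d) m∣∣d-r∣ =
  t , trans (sym (ℕ.m+[n∸m]≡n r≤d)) (cong (λ x → r + x) d∸r≡t*m)
... | no r≰d = contradiction (subst (m ∣_) (∣+m-+n∣≡n∸m d<r) m∣∣d-r∣)
                            (>⇒∤ {{ℕ.>-nonZero (ℕ.m<n⇒0<n∸m d<r)}} (ℕ.≤-<-trans (ℕ.m∸n≤m r d) r<m))
  where d<r = ℕ.≰⇒> r≰d

m∣n⇒n≡[1+w]*m : ∀ {m n} → m ∣ n → 0 < n → ∃[ w ] n ≡ suc w * m
m∣n⇒n≡[1+w]*m (divides (suc w) n≡[1+w]*m) _ = w , n≡[1+w]*m
m∣n⇒n≡[1+w]*m (divides zero refl) ()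

∈-divisors⁺ : ∀ {d N} → 0 < N → 0 < d → d ∣ N → d ∈ divisors N
∈-divisors⁺ {suc d} {N} 0<N _ d∣N =
  ∈-filter⁺ (_∣? N) (∈-map⁺ suc (∈-upTo⁺ (∣⇒≤ {{ℕ.>-nonZero 0<N}} d∣N))) d∣N

∈-divisors⁻ : ∀ {d N} → d ∈ divisors N → 0 < d × d ∣ N
∈-divisors⁻ {N = N} d∈divisors with d∈sucs , d∣N ← ∈-filter⁻ (_∣? N) {xs = map suc (upTo N)} d∈divisors
  with _ , _ , refl ← ∈-map⁻ suc d∈sucs = ℕ.z<s , d∣N

divisors-unique : ∀ N → Unique (divisors N)
divisors-unique N = Unique.filter⁺ (_∣? N) (Unique.map⁺ ℕ.suc-injective (Unique.upTo⁺ N))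

pairWithSum : ℕ → ℕ → ℤ × ℤ
pairWithSum k j = + k , + j ℤ.- + k

∣k+[j-k]∣≡j : ∀ k j → ∣ + k ℤ.+ (+ j ℤ.- + k) ∣ ≡ j
∣k+[j-k]∣≡j k j = cong ∣_∣ (k+[j-k]≡j (+ k) (+ j))
  where
  k+[j-k]≡j : ∀ k j → k ℤ.+ (j ℤ.- k) ≡ j
  k+[j-k]≡j = ℤ.solve-∀

∣k-[j-k]∣≡y : ∀ {k j y} → j + y ≡ 2 * k → ∣ + k ℤ.- (+ j ℤ.- + k) ∣ ≡ y
∣k-[j-k]∣≡y {k} {j} {y} j+y≡2k = begin
  ∣ + k ℤ.- (+ j ℤ.- + k) ∣   ≡⟨ cong ∣_∣ (k-[j-k]≡2k-j (+ k) (+ j)) ⟩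
  ∣ + (k + k) ℤ.- + j ∣       ≡⟨ cong (λ m → ∣ + m ℤ.- + j ∣) k+k≡y+j ⟩
  ∣ + (y + j) ℤ.- + j ∣       ≡⟨ ∣+[m+n]-+n∣≡m y j ⟩
  y                           ∎
  where
  open ≡-Reasoning
  k-[j-k]≡2k-j : ∀ k j → k ℤ.- (j ℤ.- k) ≡ (k ℤ.+ k) ℤ.- j
  k-[j-k]≡2k-j = ℤ.solve-∀
  k+k≡y+j : k + k ≡ y + j
  k+k≡y+j = trans (cong (λ m → k + m) (sym (ℕ.+-identityʳ k))) (trans (sym j+y≡2k) (ℕ.+-comm j y))

row : ℕ → List (ℤ × ℤ)
row k = map (pairWithSum k) (upTo (suc (2 * k)))

∈-pairs⁻ : ∀ {n x} → x ∈ pairs n → ∃[ k ] ∃[ j ] j ≤ 2 * k × x ≡ pairWithSum k j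
∈-pairs⁻ {n} x∈pairs with k , _ , x∈row ← find (∈-concatMap⁻ row {xs = upTo (suc (2 * n))} x∈pairs)
  with j , j∈ , refl ← ∈-map⁻ _ x∈row = k , j , ℕ.≤-pred (∈-upTo⁻ j∈) , refl

∈-pairs⁺ : ∀ {n k j} → k ≤ 2 * n → j ≤ 2 * k → pairWithSum k j ∈ pairs n
∈-pairs⁺ k≤2n j≤2k = ∈-concatMap⁺ row (lose (∈-upTo⁺ (s≤s k≤2n)) (∈-map⁺ _ (∈-upTo⁺ (s≤s j≤2k))))

pairs-unique : ∀ n → Unique (pairs n)
pairs-unique n = Unique.concat⁺ {xss = map row ks} (All.map⁺ (All.universal row-unique ks))
                                (AllPairs.map⁺ (AllPairs.map rows-disjoint (Unique.upTo⁺ (suc (2 * n)))))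
  where
  ks = upTo (suc (2 * n))
  row-unique : ∀ k → Unique (row k)
  row-unique k = Unique.map⁺ pairWithSum-injective (Unique.upTo⁺ _)
    where
    pairWithSum-injective : ∀ {a b} → pairWithSum k a ≡ pairWithSum k b → a ≡ b
    pairWithSum-injective {a} {b} eq = begin
      a                                 ≡⟨ ∣k+[j-k]∣≡j k a ⟨
      ∣ + k ℤ.+ (+ a ℤ.- + k) ∣         ≡⟨ cong (λ (x , y) → ∣ x ℤ.+ y ∣) eq ⟩
      ∣ + k ℤ.+ (+ b ℤ.- + k) ∣         ≡⟨ ∣k+[j-k]∣≡j k b ⟩
      b                                 ∎
      where open ≡-Reasoning
  rows-disjoint : ∀ {a b} → a ≢ b → Disjoint (row a) (row b)
  rows-disjoint a≢b (x∈row-a , x∈row-b)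
    with _ , _ , refl ← ∈-map⁻ _ x∈row-a | _ , _ , eq ← ∈-map⁻ _ x∈row-b =
    a≢b (ℤ.+-injective (cong proj₁ eq))

doubledRHS : ℕ → ℕ → ℤ × ℤ → ℤ
doubledRHS p r (k , l) = (+ p) ℤ.* (k ℤ.* k ℤ.- l ℤ.* l) ℤ.+ (+ p) ℤ.* (k ℤ.+ l) ℤ.- (+ 2) ℤ.* l ℤ.* (+ r)

module _ (p r n : ℕ) where

  Solution : ℤ × ℤ → Set
  Solution x = + (2 * n) ≡ doubledRHS p r x

  EvenSolution OddSolution : ℤ × ℤ → Set
  EvenSolution x = Solution x × sign ∣ proj₁ x ℤ.+ proj₂ x ∣ ≡ + 1
  OddSolution  x = Solution x × sign ∣ proj₁ x ℤ.+ proj₂ x ∣ ≡ ℤ.- + 1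

  evenSolution? : ∀ x → Dec (EvenSolution x)
  evenSolution? x = (+ (2 * n) ℤ.≟ doubledRHS p r x) ×-dec (sign ∣ proj₁ x ℤ.+ proj₂ x ∣ ℤ.≟ + 1)

  oddSolution? : ∀ x → Dec (OddSolution x)
  oddSolution? x = (+ (2 * n) ℤ.≟ doubledRHS p r x) ×-dec (sign ∣ proj₁ x ℤ.+ proj₂ x ∣ ℤ.≟ ℤ.- + 1)

  sumℤ-isSol≡#even-#odd : ∀ xs → sumℤ (map (isSol p r n) xs) ≡
                         + length (filter evenSolution? xs) ℤ.- + length (filter oddSolution? xs)
  sumℤ-isSol≡#even-#odd [] = refl
  sumℤ-isSol≡#even-#odd ((k , l) ∷ xs)
    with + (2 * n) ℤ.≟ doubledRHS p r (k , l)
  ... | no _ = trans (ℤ.+-identityˡ _) (sumℤ-isSol≡#even-#odd xs)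
  ... | yes _ with sign ∣ k ℤ.+ l ∣ | sign≡±1 ∣ k ℤ.+ l ∣
  ... | _ | inj₁ refl =
    trans (cong (ℤ._+_ (+ 1)) (sumℤ-isSol≡#even-#odd xs)) (1+[a-b]≡[1+a]-b #even #odd)
    where
    #even = + length (filter evenSolution? xs)
    #odd  = + length (filter oddSolution? xs)
    1+[a-b]≡[1+a]-b : ∀ a b → + 1 ℤ.+ (a ℤ.- b) ≡ (+ 1 ℤ.+ a) ℤ.- b
    1+[a-b]≡[1+a]-b = ℤ.solve-∀
  ... | _ | inj₂ refl =
    trans (cong (ℤ._+_ (ℤ.- + 1)) (sumℤ-isSol≡#even-#odd xs)) (-1+[a-b]≡a-[1+b] #even #odd)
    where
    #even = + length (filter evenSolution? xs)
    #odd  = + length (filter oddSolution? xs)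
    -1+[a-b]≡a-[1+b] : ∀ a b → ℤ.- + 1 ℤ.+ (a ℤ.- b) ≡ a ℤ.- (+ 1 ℤ.+ b)
    -1+[a-b]≡a-[1+b] = ℤ.solve-∀

*+-cancelˡ-≡ : ∀ p c {a b} .{{_ : ℕ.NonZero p}} → p * a + c ≡ p * b + c → a ≡ b
*+-cancelˡ-≡ p c {a} {b} eq = ℕ.*-cancelˡ-≡ a b p (ℕ.+-cancelʳ-≡ c (p * a) (p * b) eq)

doubledRHS-diagonal : ∀ {p r q k j y} → r + q ≡ p → j + y ≡ 2 * k →
                      doubledRHS p r (pairWithSum k j) ≡ + (j * (p * y + q) + r * y)
doubledRHS-diagonal {_} {r} {q} {k} {j} {y} refl j+y≡2k = begin
  doubledRHS (r + q) r (pairWithSum k j)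
    ≡⟨ expand (+ r) (+ q) (+ k) (+ j) (+ y) ⟩
  lhs ℤ.+ (P ℤ.* + j ℤ.+ + r) ℤ.* (+ (k + k) ℤ.- + (j + y))
    ≡⟨ cong (λ m → lhs ℤ.+ (P ℤ.* + j ℤ.+ + r) ℤ.* (+ m ℤ.- + (j + y))) k+k≡j+y ⟩
  lhs ℤ.+ (P ℤ.* + j ℤ.+ + r) ℤ.* (+ (j + y) ℤ.- + (j + y))
    ≡⟨ a+b*[c-c]≡a lhs (P ℤ.* + j ℤ.+ + r) (+ (j + y)) ⟩
  lhs
    ≡⟨ cong₂ ℤ._+_ (trans (ℤ.pos-* j _) (cong (λ m → + j ℤ.* (m ℤ.+ + q)) (ℤ.pos-* (r + q) y)))
                   (ℤ.pos-* r y) ⟨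
  + (j * ((r + q) * y + q) + r * y) ∎
  where
  open ≡-Reasoning
  P = + (r + q)
  lhs = + j ℤ.* (P ℤ.* + y ℤ.+ + q) ℤ.+ + r ℤ.* + y
  k+k≡j+y : k + k ≡ j + y
  k+k≡j+y = trans (cong (λ m → k + m) (sym (ℕ.+-identityʳ k))) (sym j+y≡2k)
  expand : ∀ r q k j y →
    (r ℤ.+ q) ℤ.* (k ℤ.* k ℤ.- (j ℤ.- k) ℤ.* (j ℤ.- k)) ℤ.+ (r ℤ.+ q) ℤ.* (k ℤ.+ (j ℤ.- k))
      ℤ.- (+ 2) ℤ.* (j ℤ.- k) ℤ.* r
    ≡ j ℤ.* ((r ℤ.+ q) ℤ.* y ℤ.+ q) ℤ.+ r ℤ.* y ℤ.+ ((r ℤ.+ q) ℤ.* j ℤ.+ r) ℤ.* ((k ℤ.+ k) ℤ.- (j ℤ.+ y))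
  expand = ℤ.solve-∀
  a+b*[c-c]≡a : ∀ a b c → a ℤ.+ b ℤ.* (c ℤ.- c) ≡ a
  a+b*[c-c]≡a = ℤ.solve-∀

module Correspondence (p r q n : ℕ) (r+q≡p : r + q ≡ p) (0<r : 0 < r) (0<q : 0 < q)
                      (r⊥2p : Coprime r (2 * p)) where

  N : ℕ
  N = 2 * p * n + r * q

  FactorPair : ℕ → ℕ → Set
  FactorPair j y = N ≡ (p * j + r) * (p * y + q)

  0<p : 0 < p
  0<p = ℕ.<-≤-trans 0<r (subst (r ≤_) r+q≡p (ℕ.m≤m+n r q))

  0<N : 0 < N
  0<N = ℕ.<-≤-trans (ℕ.<-≤-trans 0<r (ℕ.m≤m*n r q {{ℕ.>-nonZero 0<q}})) (ℕ.m≤n+m (r * q) (2 * p * n))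

  0<pj+r : ∀ j → 0 < p * j + r
  0<pj+r j = ℕ.<-≤-trans 0<r (ℕ.m≤n+m r (p * j))

  0<py+q : ∀ y → 0 < p * y + q
  0<py+q y = ℕ.<-≤-trans 0<q (ℕ.m≤n+m q (p * y))

  instance
    p≢0 : ℕ.NonZero p
    p≢0 = ℕ.>-nonZero 0<p

  factorPair⇔balanced : ∀ {j y} → FactorPair j y ⇔ (2 * n ≡ j * (p * y + q) + r * y)
  factorPair⇔balanced {j} {y} = mk⇔
    (λ fp → *+-cancelˡ-≡ p (r * q) (trans (sym N≡) (trans fp product≡)))
    (λ bal → trans N≡ (trans (cong (λ m → p * m + r * q) bal) (sym product≡)))
    where
    N≡ : 2 * p * n + r * q ≡ p * (2 * n) + r * q
    N≡ = solve (p ∷ n ∷ r ∷ q ∷ [])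
    product≡ : (p * j + r) * (p * y + q) ≡ p * (j * (p * y + q) + r * y) + r * q
    product≡ = solve (p ∷ j ∷ r ∷ y ∷ q ∷ [])

  solution-view : ∀ {x} → x ∈ pairs n → Solution p r n x →
                  ∃[ k ] ∃[ j ] ∃[ y ] x ≡ pairWithSum k j × j + y ≡ 2 * k × FactorPair j y
  solution-view x∈pairs sol with k , j , j≤2k , refl ← ∈-pairs⁻ {n} x∈pairs =
    k , j , 2 * k ∸ j , refl , j+y≡2k , Equivalence.from factorPair⇔balanced (ℤ.+-injective balanced)
    where
    j+y≡2k = ℕ.m+[n∸m]≡n j≤2k
    balanced = trans sol (doubledRHS-diagonal {k = k} {j} r+q≡p j+y≡2k)

  factorPair⇒solution : ∀ {k j y} → j + y ≡ 2 * k → FactorPair j y →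
                        pairWithSum k j ∈ pairs n × Solution p r n (pairWithSum k j)
  factorPair⇒solution {k} {j} {y} j+y≡2k fp =
    ∈-pairs⁺ {n} k≤2n (subst (j ≤_) j+y≡2k (ℕ.m≤m+n j y)) ,
    trans (cong +_ balanced) (sym (doubledRHS-diagonal {k = k} {j} r+q≡p j+y≡2k))
    where
    balanced = Equivalence.to factorPair⇔balanced fp
    k≤2n : k ≤ 2 * n
    k≤2n = begin
      k                         ≤⟨ ℕ.m≤m+n k (k + 0) ⟩
      2 * k                     ≡⟨ j+y≡2k ⟨
      j + y                     ≤⟨ ℕ.+-mono-≤ (ℕ.m≤m*n j (p * y + q) {{ℕ.>-nonZero (0<py+q y)}})
                                              (ℕ.m≤n*m y r {{ℕ.>-nonZero 0<r}}) ⟩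
      j * (p * y + q) + r * y   ≡⟨ balanced ⟨
      2 * n                     ∎
      where open ℕ.≤-Reasoning

  factorPair-injectiveˡ : ∀ {j j′ y} → FactorPair j y → FactorPair j′ y → j ≡ j′
  factorPair-injectiveˡ {y = y} fp fp′ =
    *+-cancelˡ-≡ p r (ℕ.*-cancelʳ-≡ _ _ (p * y + q) {{ℕ.>-nonZero (0<py+q y)}} (trans (sym fp) fp′))

  factorPair-injectiveʳ : ∀ {j y y′} → FactorPair j y → FactorPair j y′ → y ≡ y′
  factorPair-injectiveʳ {j} fp fp′ =
    *+-cancelˡ-≡ p q (ℕ.*-cancelˡ-≡ _ _ (p * j + r) {{ℕ.>-nonZero (0<pj+r j)}} (trans (sym fp) fp′))

  pairWithSum-determined : ∀ {k j y k′ y′} → j + y ≡ 2 * k → j + y′ ≡ 2 * k′ → y ≡ y′ →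
                       pairWithSum k j ≡ pairWithSum k′ j
  pairWithSum-determined {k} {k′ = k′} j+y≡2k j+y≡2k′ refl
    with refl ← ℕ.*-cancelˡ-≡ k k′ 2 (trans (sym j+y≡2k) j+y≡2k′) = refl

  Divisors⁺ Divisors⁻ : List ℕ
  Divisors⁺ = filter (λ d → 2 * p ∣? ∣ + d ℤ.- + r ∣) (divisors N)
  Divisors⁻ = filter (λ d → 2 * p ∣? ∣ + d ℤ.+ + r ∣) (divisors N)

  even-factor∈Divisors⁺ : ∀ {t y} → FactorPair (2 * t) y → p * (2 * t) + r ∈ Divisors⁺
  even-factor∈Divisors⁺ {t} {y} fp =
    ∈-filter⁺ _ (∈-divisors⁺ 0<N (0<pj+r (2 * t)) (divides (p * y + q) N≡ed))
                (subst (2 * p ∣_) (sym (∣+[m+n]-+n∣≡m (p * (2 * t)) r)) (divides t p[2t]≡t[2p]))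
    where
    N≡ed = trans fp (ℕ.*-comm (p * (2 * t) + r) (p * y + q))
    p[2t]≡t[2p] : p * (2 * t) ≡ t * (2 * p)
    p[2t]≡t[2p] = solve (p ∷ t ∷ [])

  p[1+2t]+q+r≡[1+t]2p : ∀ t → p * (1 + 2 * t) + q + r ≡ suc t * (2 * p)
  p[1+2t]+q+r≡[1+t]2p t rewrite sym r+q≡p = solve (r ∷ q ∷ t ∷ [])

  odd-cofactor∈Divisors⁻ : ∀ {j t} → FactorPair j (1 + 2 * t) → p * (1 + 2 * t) + q ∈ Divisors⁻
  odd-cofactor∈Divisors⁻ {j} {t} fp =
    ∈-filter⁺ _ (∈-divisors⁺ 0<N (0<py+q (1 + 2 * t)) (divides (p * j + r) fp))
                (divides (suc t) (p[1+2t]+q+r≡[1+t]2p t))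

  2p∣r*x⇒x≡[1+w]*2p : ∀ {x} → 2 * p ∣ r * x → 0 < x → ∃[ w ] x ≡ suc w * (2 * p)
  2p∣r*x⇒x≡[1+w]*2p 2p∣rx = m∣n⇒n≡[1+w]*m (coprime-divisor (Coprime.sym r⊥2p) 2p∣rx)

  -- e + r + p is e - q + 2p, written so that no truncated subtraction occurs.
  cofactor⁺ : ∀ {e t} → N ≡ e * (r + t * (2 * p)) → ∃[ w ] e ≡ p * (2 * w) + q
  cofactor⁺ {e} {t} N≡ed =
    let w , e+r+p≡[1+w]2p = 2p∣r*x⇒x≡[1+w]*2p 2p∣r[e+r+p] (ℕ.<-≤-trans 0<p (ℕ.m≤n+m p (e + r)))
    in  w , cancel w e+r+p≡[1+w]2p
    where
    cancel : ∀ w → e + r + p ≡ suc w * (2 * p) → e ≡ p * (2 * w) + q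
    cancel w e+r+p≡[1+w]2p =
      ℕ.+-cancelʳ-≡ (r + p) e (p * (2 * w) + q) (trans (sym (ℕ.+-assoc e r p)) (trans e+r+p≡[1+w]2p [1+w]2p≡))
      where
      [1+w]2p≡ : suc w * (2 * p) ≡ p * (2 * w) + q + (r + p)
      [1+w]2p≡ rewrite sym r+q≡p = solve (r ∷ q ∷ w ∷ [])
    sum≡ : 2 * p * (t * e) + r * (e + r + p) ≡ 2 * p * (n + r)
    sum≡ = begin
      2 * p * (t * e) + r * (e + r + p)   ≡⟨ solve (p ∷ t ∷ e ∷ r ∷ []) ⟩
      e * (r + t * (2 * p)) + r * (r + p) ≡⟨ cong (λ m → m + r * (r + p)) N≡ed ⟨
      N + r * (r + p)                     ≡⟨ N+r[r+p]≡ ⟩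
      2 * p * (n + r)                     ∎
      where
      open ≡-Reasoning
      N+r[r+p]≡ : 2 * p * n + r * q + r * (r + p) ≡ 2 * p * (n + r)
      N+r[r+p]≡ rewrite sym r+q≡p = solve (r ∷ q ∷ n ∷ [])
    2p∣r[e+r+p] : 2 * p ∣ r * (e + r + p)
    2p∣r[e+r+p] = ∣m+n∣m⇒∣n (subst (2 * p ∣_) (sym sum≡) (m∣m*n (n + r))) (m∣m*n (t * e))

  cofactor⁻ : ∀ {c e t} → N ≡ c * e → e + r ≡ suc t * (2 * p) → ∃[ w ] c ≡ p * (1 + 2 * w) + r
  cofactor⁻ {c} {e} {t} N≡ce e+r≡[1+t]2p =
    let w , q+c≡[1+w]2p = 2p∣r*x⇒x≡[1+w]*2p 2p∣r[q+c] (ℕ.<-≤-trans 0<q (ℕ.m≤m+n q c))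
    in  w , cancel w q+c≡[1+w]2p
    where
    cancel : ∀ w → q + c ≡ suc w * (2 * p) → c ≡ p * (1 + 2 * w) + r
    cancel w q+c≡[1+w]2p = ℕ.+-cancelˡ-≡ q c (p * (1 + 2 * w) + r) (trans q+c≡[1+w]2p [1+w]2p≡)
      where
      [1+w]2p≡ : suc w * (2 * p) ≡ q + (p * (1 + 2 * w) + r)
      [1+w]2p≡ rewrite sym r+q≡p = solve (r ∷ q ∷ w ∷ [])
    sum≡ : 2 * p * n + r * (q + c) ≡ 2 * p * (suc t * c)
    sum≡ = begin
      2 * p * n + r * (q + c)       ≡⟨ solve (p ∷ n ∷ r ∷ q ∷ c ∷ []) ⟩
      2 * p * n + r * q + r * c     ≡⟨ cong (λ m → m + r * c) N≡ce ⟩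
      c * e + r * c                 ≡⟨ solve (c ∷ e ∷ r ∷ []) ⟩
      c * (e + r)                   ≡⟨ cong (c *_) e+r≡[1+t]2p ⟩
      c * (suc t * (2 * p))         ≡⟨ solve (c ∷ t ∷ p ∷ []) ⟩
      2 * p * (suc t * c)           ∎
      where open ≡-Reasoning
    2p∣r[q+c] : 2 * p ∣ r * (q + c)
    2p∣r[q+c] = ∣m+n∣m⇒∣n (subst (2 * p ∣_) (sym sum≡) (m∣m*n (suc t * c))) (m∣m*n n)

  r<2p : r < 2 * p
  r<2p = ℕ.<-≤-trans (subst (r <_) r+q≡p (ℕ.m<m+n r 0<q)) (ℕ.m≤m+n p (p + 0))

  Divisors⁺⇒factorPair : ∀ {d} → d ∈ Divisors⁺ →
                         ∃[ t ] ∃[ w ] FactorPair (2 * t) (2 * w) × d ≡ p * (2 * t) + r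
  Divisors⁺⇒factorPair d∈Divisors⁺
    with d∈divisors , 2p∣∣d-r∣ ← ∈-filter⁻ (λ d → 2 * p ∣? ∣ + d ℤ.- + r ∣) {xs = divisors N} d∈Divisors⁺
    with _ , divides e N≡ed ← ∈-divisors⁻ {N = N} d∈divisors
    with t , refl ← m∣∣d-r∣⇒d≡r+t*m r<2p 2p∣∣d-r∣
    with w , refl ← cofactor⁺ {e} {t} N≡ed
    = t , w , trans N≡ed (solve (p ∷ t ∷ r ∷ w ∷ q ∷ [])) , solve (r ∷ t ∷ p ∷ [])

  Divisors⁻⇒factorPair : ∀ {e} → e ∈ Divisors⁻ →
                         ∃[ t ] ∃[ w ] FactorPair (1 + 2 * w) (1 + 2 * t) × e ≡ p * (1 + 2 * t) + q
  Divisors⁻⇒factorPair {e} e∈Divisors⁻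
    with e∈divisors , 2p∣e+r ← ∈-filter⁻ (λ d → 2 * p ∣? ∣ + d ℤ.+ + r ∣) {xs = divisors N} e∈Divisors⁻
    with _ , divides c N≡ce ← ∈-divisors⁻ {N = N} e∈divisors
    with t , e+r≡[1+t]2p ← m∣n⇒n≡[1+w]*m 2p∣e+r (ℕ.<-≤-trans 0<r (ℕ.m≤n+m r e))
    with w , refl ← cofactor⁻ {c} {e} {t} N≡ce e+r≡[1+t]2p
    with refl ← ℕ.+-cancelʳ-≡ r e (p * (1 + 2 * t) + q) (trans e+r≡[1+t]2p (sym (p[1+2t]+q+r≡[1+t]2p t)))
    = t , w , N≡ce , refl

  divisor⁺ divisor⁻ : ℤ × ℤ → ℕ
  divisor⁺ (k , l) = p * ∣ k ℤ.+ l ∣ + r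
  divisor⁻ (k , l) = p * ∣ k ℤ.- l ∣ + q

  divisor⁺-pairWithSum : ∀ k j → divisor⁺ (pairWithSum k j) ≡ p * j + r
  divisor⁺-pairWithSum k j = cong (λ m → p * m + r) (∣k+[j-k]∣≡j k j)

  divisor⁻-pairWithSum : ∀ {k j y} → j + y ≡ 2 * k → divisor⁻ (pairWithSum k j) ≡ p * y + q
  divisor⁻-pairWithSum {k} j+y≡2k = cong (λ m → p * m + q) (∣k-[j-k]∣≡y {k} j+y≡2k)

  divisor⁺-injective : ∀ {x x′} → x ∈ pairs n → Solution p r n x → x′ ∈ pairs n → Solution p r n x′ →
                       divisor⁺ x ≡ divisor⁺ x′ → x ≡ x′
  divisor⁺-injective x∈pairs sol x′∈pairs sol′ eq
    with k , j , y , refl , j+y≡2k , fp ← solution-view x∈pairs sol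
    with k′ , j′ , y′ , refl , j+y′≡2k′ , fp′ ← solution-view x′∈pairs sol′
    with refl ← *+-cancelˡ-≡ p r (trans (sym (divisor⁺-pairWithSum k j))
                                       (trans eq (divisor⁺-pairWithSum k′ j′)))
    = pairWithSum-determined j+y≡2k j+y′≡2k′ (factorPair-injectiveʳ fp fp′)

  divisor⁻-injective : ∀ {x x′} → x ∈ pairs n → Solution p r n x → x′ ∈ pairs n → Solution p r n x′ →
                       divisor⁻ x ≡ divisor⁻ x′ → x ≡ x′
  divisor⁻-injective x∈pairs sol x′∈pairs sol′ eq
    with k , j , y , refl , j+y≡2k , fp ← solution-view x∈pairs sol
    with k′ , j′ , y′ , refl , j′+y′≡2k′ , fp′ ← solution-view x′∈pairs sol′
    with refl ← *+-cancelˡ-≡ p q {y} {y′} (trans (sym (divisor⁻-pairWithSum {k} j+y≡2k))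
                                                (trans eq (divisor⁻-pairWithSum {k′} j′+y′≡2k′)))
    with refl ← factorPair-injectiveˡ {j} {j′} fp fp′
    = pairWithSum-determined j+y≡2k j′+y′≡2k′ refl

  EvenSolutions OddSolutions : List (ℤ × ℤ)
  EvenSolutions = filter (evenSolution? p r n) (pairs n)
  OddSolutions  = filter (oddSolution? p r n) (pairs n)

  even-factorPair⇒EvenSolution : ∀ {t w} → FactorPair (2 * t) (2 * w) →
                                 pairWithSum (t + w) (2 * t) ∈ EvenSolutions ×
                                 divisor⁺ (pairWithSum (t + w) (2 * t)) ≡ p * (2 * t) + r
  even-factorPair⇒EvenSolution {t} {w} fp =
    ∈-filter⁺ (evenSolution? p r n) x∈pairs
              (sol , trans (cong sign (∣k+[j-k]∣≡j (t + w) (2 * t))) (sign-2* t)) ,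
    divisor⁺-pairWithSum (t + w) (2 * t)
    where
    x∈pairs×sol = factorPair⇒solution {t + w} {2 * t} {2 * w} (sym (ℕ.*-distribˡ-+ 2 t w)) fp
    x∈pairs = proj₁ x∈pairs×sol
    sol = proj₂ x∈pairs×sol

  odd-factorPair⇒OddSolution : ∀ {t w} → FactorPair (1 + 2 * w) (1 + 2 * t) →
                               pairWithSum (1 + w + t) (1 + 2 * w) ∈ OddSolutions ×
                               divisor⁻ (pairWithSum (1 + w + t) (1 + 2 * w)) ≡ p * (1 + 2 * t) + q
  odd-factorPair⇒OddSolution {t} {w} fp =
    ∈-filter⁺ (oddSolution? p r n) x∈pairs
              (sol , trans (cong sign (∣k+[j-k]∣≡j (1 + w + t) (1 + 2 * w))) (sign-1+2* w)) ,
    divisor⁻-pairWithSum {1 + w + t} {1 + 2 * w} {1 + 2 * t} j+y≡2k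
    where
    j+y≡2k : 1 + 2 * w + (1 + 2 * t) ≡ 2 * (1 + w + t)
    j+y≡2k = solve (w ∷ t ∷ [])
    x∈pairs×sol = factorPair⇒solution {1 + w + t} {1 + 2 * w} {1 + 2 * t} j+y≡2k fp
    x∈pairs = proj₁ x∈pairs×sol
    sol = proj₂ x∈pairs×sol

  #EvenSolutions≡#Divisors⁺ : length EvenSolutions ≡ length Divisors⁺
  #EvenSolutions≡#Divisors⁺ =
    length-≡-via-bijection divisor⁺ (Unique.filter⁺ (evenSolution? p r n) (pairs-unique n))
                           (Unique.filter⁺ (λ d → 2 * p ∣? ∣ + d ℤ.- + r ∣) (divisors-unique N))
                           injective into onto
    where
    injective : ∀ {x x′} → x ∈ EvenSolutions → x′ ∈ EvenSolutions → divisor⁺ x ≡ divisor⁺ x′ → x ≡ x′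
    injective x∈ x′∈
      with x∈pairs , sol , _ ← ∈-filter⁻ (evenSolution? p r n) {xs = pairs n} x∈
      with x′∈pairs , sol′ , _ ← ∈-filter⁻ (evenSolution? p r n) {xs = pairs n} x′∈
      = divisor⁺-injective x∈pairs sol x′∈pairs sol′
    into : ∀ {x} → x ∈ EvenSolutions → divisor⁺ x ∈ Divisors⁺
    into x∈
      with x∈pairs , sol , sign≡1 ← ∈-filter⁻ (evenSolution? p r n) {xs = pairs n} x∈
      with k , j , y , refl , _ , fp ← solution-view x∈pairs sol
      with t , refl ← sign≡1⇒even {j} (trans (cong sign (sym (∣k+[j-k]∣≡j k j))) sign≡1)
      = subst (_∈ Divisors⁺) (sym (divisor⁺-pairWithSum k (2 * t))) (even-factor∈Divisors⁺ {t} fp)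
    onto : ∀ {d} → d ∈ Divisors⁺ → ∃[ x ] x ∈ EvenSolutions × divisor⁺ x ≡ d
    onto d∈ =
      let t , w , fp , d≡ = Divisors⁺⇒factorPair d∈
          x∈ , divisor⁺x≡ = even-factorPair⇒EvenSolution {t} {w} fp
      in  pairWithSum (t + w) (2 * t) , x∈ , trans divisor⁺x≡ (sym d≡)

  #OddSolutions≡#Divisors⁻ : length OddSolutions ≡ length Divisors⁻
  #OddSolutions≡#Divisors⁻ =
    length-≡-via-bijection divisor⁻ (Unique.filter⁺ (oddSolution? p r n) (pairs-unique n))
                           (Unique.filter⁺ (λ d → 2 * p ∣? ∣ + d ℤ.+ + r ∣) (divisors-unique N))
                           injective into onto
    where
    injective : ∀ {x x′} → x ∈ OddSolutions → x′ ∈ OddSolutions → divisor⁻ x ≡ divisor⁻ x′ → x ≡ x′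
    injective x∈ x′∈
      with x∈pairs , sol , _ ← ∈-filter⁻ (oddSolution? p r n) {xs = pairs n} x∈
      with x′∈pairs , sol′ , _ ← ∈-filter⁻ (oddSolution? p r n) {xs = pairs n} x′∈
      = divisor⁻-injective x∈pairs sol x′∈pairs sol′
    into : ∀ {x} → x ∈ OddSolutions → divisor⁻ x ∈ Divisors⁻
    into x∈
      with x∈pairs , sol , sign≡-1 ← ∈-filter⁻ (oddSolution? p r n) {xs = pairs n} x∈
      with k , j , y , refl , j+y≡2k , fp ← solution-view x∈pairs sol
      with t , refl ← sign≡-1⇒odd {y} (trans (sym (j+y≡2k⇒sign-j≡sign-y {j} {y} {k} j+y≡2k))
                                         (trans (cong sign (sym (∣k+[j-k]∣≡j k j))) sign≡-1))
      = subst (_∈ Divisors⁻) (sym (divisor⁻-pairWithSum {k} j+y≡2k)) (odd-cofactor∈Divisors⁻ {j} {t} fp)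
    onto : ∀ {e} → e ∈ Divisors⁻ → ∃[ x ] x ∈ OddSolutions × divisor⁻ x ≡ e
    onto e∈ =
      let t , w , fp , e≡ = Divisors⁻⇒factorPair e∈
          x∈ , divisor⁻x≡ = odd-factorPair⇒OddSolution {t} {w} fp
      in  pairWithSum (1 + w + t) (1 + 2 * w) , x∈ , trans divisor⁻x≡ (sym e≡)

  E≡signedSum : E (+ r) N (2 * p) ≡ signedSum p r n
  E≡signedSum = begin
    E (+ r) N (2 * p)                                          ≡⟨⟩
    + length Divisors⁺ ℤ.- + length Divisors⁻                  ≡⟨ cong₂ (λ a b → + a ℤ.- + b)
                                                                        #EvenSolutions≡#Divisors⁺
                                                                        #OddSolutions≡#Divisors⁻ ⟨
    + length EvenSolutions ℤ.- + length OddSolutions           ≡⟨ sumℤ-isSol≡#even-#odd p r n (pairs n) ⟨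
    signedSum p r n                                            ∎
    where open ≡-Reasoning

theorem1p1 : (p r : ℕ) → 0 < r → r < p → gcd r (2 * p) ≡ 1 →
    (n : ℕ) → E (+ r) (2 * p * n + r * (p ∸ r)) (2 * p) ≡ signedSum p r n
theorem1p1 p r 0<r r<p gcd[r,2p]≡1 n =
  Correspondence.E≡signedSum p r (p ∸ r) n (ℕ.m+[n∸m]≡n (ℕ.<⇒≤ r<p)) 0<r (ℕ.m<n⇒0<n∸m r<p)
                             (gcd≡1⇒coprime gcd[r,2p]≡1)
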